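{- Let $G_1,\dots,G_k$ be finite simple graphs and let $G=G_1+G_2+\dots+G_k$ be their iterated join. Then $$\mathrm{dim}\,G=(k-1)+\mathrm{dim}\,G_1+\mathrm{dim}\,G_2+\dots+\mathrm{dim}\,G_k.$$
   Context: All graphs are finite simple graphs; $|G|$ is the number of vertices of $G$. The join $G_1+G_2$ of two graphs is the graph obtained from the disjoint union of $G_1$ and $G_2$ by adding an edge between every vertex of $G_1$ and every vertex of $G_2$ (the join is associative). For a vertex $v$ of $G$, the unit sphere $S_G(v)$ is the subgraph of $G$ induced on the set of neighbors of $v$. The inductive dimension is defined recursively: $\mathrm{dim}\,G=-1$ if $G$ is the empty graph; otherwise $\mathrm{dim}\,G=\frac{1}{|G|}\sum_{v\in V(G)}\mathrm{dim}_G(v)$, where $\mathrm{dim}_G(v)=1+\mathrm{dim}\,S_G(v)$. -}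

module Defs where

open import Data.Bool using (Bool; true; false; if_then_else_)
open import Data.Nat as ℕ using (ℕ; zero; suc)
open import Data.Integer using (+_)
open import Data.Fin using (Fin; splitAt)
open import Data.Fin.Subset using (Subset; ⊤; _∩_; ∣_∣)
open import Data.List using (List; foldr; map)
open import Data.List using () renaming (allFin to allFinL)
open import Data.Vec as Vec using (Vec; []; _∷_; lookup; tabulate)
open import Data.Sum using (inj₁; inj₂)
open import Data.Rational using (ℚ; _+_; _*_; _-_; _/_; 0ℚ; 1ℚ; -_)
open import Relation.Binary.PropositionalEquality using (_≡_; refl)

record Graph : Set where
  field
    size   : ℕ
    adj    : Fin size → Fin size → Bool
    sym    : ∀ u v → adj u v ≡ adj v u
    irrefl : ∀ v → adj v v ≡ false
open Graph public

nbhd : (G : Graph) → Fin (size G) → Subset (size G)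
nbhd G v = tabulate (adj G v)

sumℚ : List ℚ → ℚ
sumℚ = foldr _+_ 0ℚ

-- dimAux G f S : the inductive dimension of the subgraph of G induced on S,
-- computed with recursion fuel f.  It is correct whenever ∣ S ∣ ≤ f, since
-- the unit sphere of v in G[S] is G[S ∩ N(v)] which misses v (G simple).
dimAux : (G : Graph) → ℕ → Subset (size G) → ℚ
dimAux G zero    S = - 1ℚ
dimAux G (suc f) S with ∣ S ∣
... | zero  = - 1ℚ
... | suc m = sumℚ (map term (allFinL (size G))) * (+ 1 / suc m)
  where
  term : Fin (size G) → ℚ
  term v = if lookup S v then 1ℚ + dimAux G f (S ∩ nbhd G v) else 0ℚ

dim : Graph → ℚ
dim G = dimAux G (size G) ⊤

joinAdj : (G₁ G₂ : Graph) → Fin (size G₁ ℕ.+ size G₂) → Fin (size G₁ ℕ.+ size G₂) → Bool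
joinAdj G₁ G₂ u v with splitAt (size G₁) u | splitAt (size G₁) v
... | inj₁ a | inj₁ b = adj G₁ a b
... | inj₂ a | inj₂ b = adj G₂ a b
... | inj₁ _ | inj₂ _ = true
... | inj₂ _ | inj₁ _ = true

joinAdj-sym : (G₁ G₂ : Graph) → ∀ u v → joinAdj G₁ G₂ u v ≡ joinAdj G₁ G₂ v u
joinAdj-sym G₁ G₂ u v with splitAt (size G₁) u | splitAt (size G₁) v
... | inj₁ a | inj₁ b = sym G₁ a b
... | inj₂ a | inj₂ b = sym G₂ a b
... | inj₁ _ | inj₂ _ = refl
... | inj₂ _ | inj₁ _ = refl

joinAdj-irrefl : (G₁ G₂ : Graph) → ∀ v → joinAdj G₁ G₂ v v ≡ false
joinAdj-irrefl G₁ G₂ v with splitAt (size G₁) v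
... | inj₁ a = irrefl G₁ a
... | inj₂ a = irrefl G₂ a

_⊕_ : Graph → Graph → Graph
G₁ ⊕ G₂ = record
  { size   = size G₁ ℕ.+ size G₂
  ; adj    = joinAdj G₁ G₂
  ; sym    = joinAdj-sym G₁ G₂
  ; irrefl = joinAdj-irrefl G₁ G₂
  }

-- The empty graph (only used for the irrelevant case of zero graphs).
emptyGraph : Graph
emptyGraph = record { size = 0 ; adj = λ () ; sym = λ () ; irrefl = λ () }

joinAll : ∀ {k} → Vec Graph k → Graph
joinAll []            = emptyGraph
joinAll (G ∷ [])      = G
joinAll (G ∷ H ∷ Gs)  = G ⊕ joinAll (H ∷ Gs)

sumDims : ∀ {k} → Vec Graph k → ℚ
sumDims Gs = Vec.foldr _ (λ G r → dim G + r) 0ℚ Gs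

-- Write δ = 1 + dim, so that |G| · dim G is the sum of δ over the unit
-- spheres of G. In G₁ + G₂ the unit sphere of a vertex v of G₁ is
-- S_{G₁}(v) + G₂, and symmetrically for G₂. By induction on the number of
-- vertices, applied to joins G₁[S] + G₂[T] of induced subgraphs, the sum over
-- the unit spheres of G₁ + G₂ therefore splits as |G₁| (dim G₁ + δ G₂) +
-- |G₂| (dim G₂ + δ G₁), which gives δ(G₁ + G₂) = δ G₁ + δ G₂. Iterating over
-- the k graphs yields the formula.
module Submission where

open import Defs hiding (sym)
open import Data.Nat using (ℕ; _≤_)
open import Data.Integer using (+_)
open import Data.Vec using (Vec)
open import Data.Rational using (_+_; _-_; _/_; 1ℚ)
open import Relation.Binary.PropositionalEquality using (_≡_)

open import Algebra.Bundles using (CommutativeMonoid)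
open import Data.Bool using (true; false; if_then_else_)
open import Data.Nat as ℕ using (zero; suc; _<_; s≤s)
import Data.Nat.Properties as ℕ
import Data.Integer as ℤ
import Data.Integer.Properties as ℤ
open import Data.Fin using (Fin; zero; suc; _↑ˡ_; _↑ʳ_)
import Data.Fin.Properties as Fin
open import Data.Fin.Subset using (Subset; ⊤; _∩_; ∣_∣)
open import Data.Fin.Subset.Properties using (∣p∩q∣≤∣p∣; ∣⊤∣≡n; ∩-identityʳ)
import Data.List as List
import Data.List.Properties as List
open import Data.Vec as Vec using ([]; _∷_; lookup; tabulate; _++_)
import Data.Vec.Properties as Vec
open import Data.Rational using (ℚ; _*_; 0ℚ; -_; toℚᵘ)
open import Data.Rational.Properties
open import Data.Rational.Unnormalised as ℚᵘ using (mkℚᵘ; *≡*) renaming (_≃_ to _≃ᵘ_)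
import Data.Rational.Unnormalised.Properties as ℚᵘ
import Data.Rational.Solver as ℚ-Solver
import Data.Integer.Solver as ℤ-Solver
open import Algebra.Properties.CommutativeSemigroup
  (CommutativeMonoid.commutativeSemigroup +-0-commutativeMonoid) using (interchange)
open import Function using (_∘_)
open import Relation.Binary.PropositionalEquality
  using (refl; sym; trans; cong; cong₂; module ≡-Reasoning)

fromℕ : ℕ → ℚ
fromℕ n = + n / 1

toℚᵘ-fromℕ : ∀ n → toℚᵘ (fromℕ n) ≃ᵘ mkℚᵘ (+ n) 0
toℚᵘ-fromℕ n = toℚᵘ-fromℚᵘ (mkℚᵘ (+ n) 0)

fromℕ-+ : ∀ m n → fromℕ (m ℕ.+ n) ≡ fromℕ m + fromℕ n
fromℕ-+ m n = toℚᵘ-injective (begin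
  toℚᵘ (fromℕ (m ℕ.+ n))                  ≈⟨ toℚᵘ-fromℕ (m ℕ.+ n) ⟩
  mkℚᵘ (+ (m ℕ.+ n)) 0                    ≈⟨ *≡* integer-identity ⟩
  mkℚᵘ (+ m) 0 ℚᵘ.+ mkℚᵘ (+ n) 0          ≈⟨ ℚᵘ.+-cong (toℚᵘ-fromℕ m) (toℚᵘ-fromℕ n) ⟨
  toℚᵘ (fromℕ m) ℚᵘ.+ toℚᵘ (fromℕ n)      ≈⟨ toℚᵘ-homo-+ (fromℕ m) (fromℕ n) ⟨
  toℚᵘ (fromℕ m + fromℕ n)                ∎)
  where
  open ℚᵘ.≃-Reasoning
  integer-identity : + (m ℕ.+ n) ℤ.* (+ 1 ℤ.* + 1) ≡ (+ m ℤ.* + 1 ℤ.+ + n ℤ.* + 1) ℤ.* + 1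
  integer-identity rewrite ℤ.pos-+ m n = solve 2 (λ a b →
    (a :+ b) :* (con (+ 1) :* con (+ 1)) := (a :* con (+ 1) :+ b :* con (+ 1)) :* con (+ 1)) refl (+ m) (+ n)
    where open ℤ-Solver.+-*-Solver

1/[1+m]*[1+m]≡1 : ∀ m → (+ 1 / suc m) * fromℕ (suc m) ≡ 1ℚ
1/[1+m]*[1+m]≡1 m = toℚᵘ-injective (begin
  toℚᵘ ((+ 1 / suc m) * fromℕ (suc m))              ≈⟨ toℚᵘ-homo-* (+ 1 / suc m) (fromℕ (suc m)) ⟩
  toℚᵘ (+ 1 / suc m) ℚᵘ.* toℚᵘ (fromℕ (suc m))      ≈⟨ ℚᵘ.*-cong (toℚᵘ-fromℚᵘ (mkℚᵘ (+ 1) m)) (toℚᵘ-fromℕ (suc m)) ⟩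
  mkℚᵘ (+ 1) m ℚᵘ.* mkℚᵘ (+ suc m) 0                ≈⟨ *≡* (ℤ.*-assoc (+ 1) (+ suc m) (+ 1)) ⟩
  ℚᵘ.1ℚᵘ                                            ≈⟨ toℚᵘ-fromℚᵘ ℚᵘ.1ℚᵘ ⟨
  toℚᵘ 1ℚ                                           ∎)
  where open ℚᵘ.≃-Reasoning

*-cancelˡ-fromℕ-suc : ∀ m {x y} → fromℕ (suc m) * x ≡ fromℕ (suc m) * y → x ≡ y
*-cancelˡ-fromℕ-suc m {x} {y} eq = trans (sym (undo x)) (trans (cong (+ 1 / suc m *_) eq) (undo y))
  where
  undo : ∀ z → (+ 1 / suc m) * (fromℕ (suc m) * z) ≡ z
  undo z = begin
    (+ 1 / suc m) * (fromℕ (suc m) * z)  ≡⟨ *-assoc (+ 1 / suc m) (fromℕ (suc m)) z ⟨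
    (+ 1 / suc m) * fromℕ (suc m) * z    ≡⟨ cong (_* z) (1/[1+m]*[1+m]≡1 m) ⟩
    1ℚ * z                               ≡⟨ *-identityˡ z ⟩
    z                                    ∎
    where open ≡-Reasoning

∑∈ : ∀ {n} → Subset n → (Fin n → ℚ) → ℚ
∑∈ []          f = 0ℚ
∑∈ (true  ∷ S) f = f zero + ∑∈ S (f ∘ suc)
∑∈ (false ∷ S) f = ∑∈ S (f ∘ suc)

syntax ∑∈ S (λ v → x) = ∑[ v ∈ S ] x

sumℚ-map-allFin : ∀ {n} (S : Subset n) (f : Fin n → ℚ) →
  sumℚ (List.map (λ v → if lookup S v then f v else 0ℚ) (List.allFin n)) ≡ ∑[ v ∈ S ] f v
sumℚ-map-allFin [] f = refl
sumℚ-map-allFin {suc n} (b ∷ S) f = begin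
  sumℚ (List.map h (List.allFin (suc n)))
    ≡⟨ cong (λ vs → h zero + sumℚ vs) (List.map-tabulate suc h) ⟩
  h zero + sumℚ (List.tabulate (h ∘ suc))
    ≡⟨ cong (λ vs → h zero + sumℚ vs) (List.map-tabulate (λ v → v) (h ∘ suc)) ⟨
  h zero + sumℚ (List.map (h ∘ suc) (List.allFin n))
    ≡⟨ cong (_+_ (h zero)) (sumℚ-map-allFin S (f ∘ suc)) ⟩
  h zero + ∑[ v ∈ S ] f (suc v)
    ≡⟨ head-step b ⟩
  ∑[ v ∈ b ∷ S ] f v ∎
  where
  open ≡-Reasoning
  h : Fin (suc n) → ℚ
  h v = if lookup (b ∷ S) v then f v else 0ℚ
  head-step : ∀ b → (if b then f zero else 0ℚ) + ∑[ v ∈ S ] f (suc v) ≡ ∑[ v ∈ b ∷ S ] f v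
  head-step true  = refl
  head-step false = +-identityˡ _

∑∈-cong : ∀ {n} (S : Subset n) {f g : Fin n → ℚ} →
  (∀ v → lookup S v ≡ true → f v ≡ g v) → ∑[ v ∈ S ] f v ≡ ∑[ v ∈ S ] g v
∑∈-cong []          eq = refl
∑∈-cong (true  ∷ S) eq = cong₂ _+_ (eq zero refl) (∑∈-cong S (eq ∘ suc))
∑∈-cong (false ∷ S) eq = ∑∈-cong S (eq ∘ suc)

∑∈-empty : ∀ {n} (S : Subset n) (f : Fin n → ℚ) → ∣ S ∣ ≡ 0 → ∑[ v ∈ S ] f v ≡ 0ℚ
∑∈-empty []          f _ = refl
∑∈-empty (false ∷ S) f e = ∑∈-empty S (f ∘ suc) e

∑∈-const : ∀ {n} (S : Subset n) (c : ℚ) → ∑[ v ∈ S ] c ≡ fromℕ ∣ S ∣ * c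
∑∈-const []          c = sym (*-zeroˡ c)
∑∈-const (false ∷ S) c = ∑∈-const S c
∑∈-const (true  ∷ S) c = begin
  c + ∑[ v ∈ S ] c            ≡⟨ cong (_+_ c) (∑∈-const S c) ⟩
  c + fromℕ ∣ S ∣ * c         ≡⟨ cong (_+ fromℕ ∣ S ∣ * c) (*-identityˡ c) ⟨
  1ℚ * c + fromℕ ∣ S ∣ * c    ≡⟨ *-distribʳ-+ c 1ℚ (fromℕ ∣ S ∣) ⟨
  (1ℚ + fromℕ ∣ S ∣) * c      ≡⟨ cong (_* c) (fromℕ-+ 1 ∣ S ∣) ⟨
  fromℕ (suc ∣ S ∣) * c       ∎
  where open ≡-Reasoning

∑∈-+ : ∀ {n} (S : Subset n) (f g : Fin n → ℚ) →
  ∑[ v ∈ S ] (f v + g v) ≡ ∑[ v ∈ S ] f v + ∑[ v ∈ S ] g v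
∑∈-+ []          f g = sym (+-identityˡ 0ℚ)
∑∈-+ (false ∷ S) f g = ∑∈-+ S (f ∘ suc) (g ∘ suc)
∑∈-+ (true  ∷ S) f g = trans (cong (_+_ (f zero + g zero)) (∑∈-+ S (f ∘ suc) (g ∘ suc)))
                             (interchange (f zero) (g zero) _ _)

∑∈-++ : ∀ {n m} (S : Subset n) (T : Subset m) (f : Fin (n ℕ.+ m) → ℚ) →
  ∑[ u ∈ S ++ T ] f u ≡ ∑[ v ∈ S ] f (v ↑ˡ m) + ∑[ w ∈ T ] f (n ↑ʳ w)
∑∈-++ []          T f = sym (+-identityˡ _)
∑∈-++ (false ∷ S) T f = ∑∈-++ S T (f ∘ suc)
∑∈-++ (true  ∷ S) T f = trans (cong (_+_ (f zero)) (∑∈-++ S T (f ∘ suc))) (sym (+-assoc (f zero) _ _))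

∣p∩q∣<∣p∣ : ∀ {n} (p q : Subset n) {v} → lookup p v ≡ true → lookup q v ≡ false → ∣ p ∩ q ∣ < ∣ p ∣
∣p∩q∣<∣p∣ (true  ∷ p) (false ∷ q) {zero}  _   _   = s≤s (∣p∩q∣≤∣p∣ p q)
∣p∩q∣<∣p∣ (true  ∷ p) (true  ∷ q) {suc v} v∈p v∉q = s≤s (∣p∩q∣<∣p∣ p q v∈p v∉q)
∣p∩q∣<∣p∣ (true  ∷ p) (false ∷ q) {suc v} v∈p v∉q = ℕ.m≤n⇒m≤1+n (∣p∩q∣<∣p∣ p q v∈p v∉q)
∣p∩q∣<∣p∣ (false ∷ p) (_     ∷ q) {suc v} v∈p v∉q = ∣p∩q∣<∣p∣ p q v∈p v∉q

∣p++q∣≡∣p∣+∣q∣ : ∀ {n m} (p : Subset n) (q : Subset m) → ∣ p ++ q ∣ ≡ ∣ p ∣ ℕ.+ ∣ q ∣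
∣p++q∣≡∣p∣+∣q∣ []          q = refl
∣p++q∣≡∣p∣+∣q∣ (true  ∷ p) q = cong suc (∣p++q∣≡∣p∣+∣q∣ p q)
∣p++q∣≡∣p∣+∣q∣ (false ∷ p) q = ∣p++q∣≡∣p∣+∣q∣ p q

⊤++⊤ : ∀ n {m} → ⊤ {n} ++ ⊤ {m} ≡ ⊤
⊤++⊤ zero    = refl
⊤++⊤ (suc n) = cong (true ∷_) (⊤++⊤ n)

tabulate-++ : ∀ {A : Set} n {m} (f : Fin (n ℕ.+ m) → A) →
  tabulate f ≡ tabulate (f ∘ (_↑ˡ m)) ++ tabulate (f ∘ (n ↑ʳ_))
tabulate-++ zero    f = refl
tabulate-++ (suc n) f = cong (f zero ∷_) (tabulate-++ n (f ∘ suc))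

tabulate-const : ∀ {A : Set} n (x : A) → tabulate {n = n} (λ _ → x) ≡ Vec.replicate n x
tabulate-const zero    x = refl
tabulate-const (suc n) x = cong (x ∷_) (tabulate-const n x)

unitSphere : (G : Graph) → Subset (size G) → Fin (size G) → Subset (size G)
unitSphere G S v = S ∩ nbhd G v

∣unitSphere∣<∣S∣ : ∀ G S {v} → lookup S v ≡ true → ∣ unitSphere G S v ∣ < ∣ S ∣
∣unitSphere∣<∣S∣ G S {v} v∈S =
  ∣p∩q∣<∣p∣ S (nbhd G v) v∈S (trans (Vec.lookup∘tabulate (adj G v) v) (irrefl G v))

∣unitSphere∣≤pred∣S∣ : ∀ G S {v m} → ∣ S ∣ ≡ suc m → lookup S v ≡ true → ∣ unitSphere G S v ∣ ≤ m
∣unitSphere∣≤pred∣S∣ G S e v∈S = ℕ.s≤s⁻¹ (ℕ.≤-trans (∣unitSphere∣<∣S∣ G S v∈S) (ℕ.≤-reflexive e))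

dimAux-empty : ∀ G f S → ∣ S ∣ ≡ 0 → dimAux G f S ≡ - 1ℚ
dimAux-empty G zero    S e = refl
dimAux-empty G (suc f) S e with ∣ S ∣
... | zero = refl

*-dimAux-suc : ∀ G f S {m} → ∣ S ∣ ≡ suc m →
  fromℕ (suc m) * dimAux G (suc f) S ≡ ∑[ v ∈ S ] (1ℚ + dimAux G f (unitSphere G S v))
*-dimAux-suc G f S {m} e with ∣ S ∣
*-dimAux-suc G f S {m} refl | .(suc m) = begin
  k * (sumℚ (List.map _ (List.allFin (size G))) * c)
                   ≡⟨ cong (λ s → k * (s * c)) (sumℚ-map-allFin S _) ⟩
  k * (Σ * c)      ≡⟨ cong (k *_) (*-comm Σ c) ⟩
  k * (c * Σ)      ≡⟨ *-assoc k c Σ ⟨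
  k * c * Σ        ≡⟨ cong (_* Σ) (trans (*-comm k c) (1/[1+m]*[1+m]≡1 m)) ⟩
  1ℚ * Σ           ≡⟨ *-identityˡ Σ ⟩
  Σ                ∎
  where
  open ≡-Reasoning
  k c Σ : ℚ
  k = fromℕ (suc m)
  c = + 1 / suc m
  Σ = ∑[ v ∈ S ] (1ℚ + dimAux G f (unitSphere G S v))

dimAux-fuel : ∀ G {f g} S → ∣ S ∣ ≤ f → ∣ S ∣ ≤ g → dimAux G f S ≡ dimAux G g S
dimAux-fuel G {f} {g} S p q with ∣ S ∣ in e
... | zero = trans (dimAux-empty G f S e) (sym (dimAux-empty G g S e))
dimAux-fuel G {suc f} {suc g} S (s≤s p) (s≤s q) | suc m =
  *-cancelˡ-fromℕ-suc m (begin
    fromℕ (suc m) * dimAux G (suc f) S                     ≡⟨ *-dimAux-suc G f S e ⟩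
    ∑[ v ∈ S ] (1ℚ + dimAux G f (unitSphere G S v))        ≡⟨ ∑∈-cong S sphere-fuel ⟩
    ∑[ v ∈ S ] (1ℚ + dimAux G g (unitSphere G S v))        ≡⟨ *-dimAux-suc G g S e ⟨
    fromℕ (suc m) * dimAux G (suc g) S                     ∎)
  where
  open ≡-Reasoning
  sphere-fuel : ∀ v → lookup S v ≡ true →
    1ℚ + dimAux G f (unitSphere G S v) ≡ 1ℚ + dimAux G g (unitSphere G S v)
  sphere-fuel v v∈S = cong (_+_ 1ℚ) (dimAux-fuel G (unitSphere G S v)
    (ℕ.≤-trans (∣unitSphere∣≤pred∣S∣ G S e v∈S) p) (ℕ.≤-trans (∣unitSphere∣≤pred∣S∣ G S e v∈S) q))

dimOn : (G : Graph) → Subset (size G) → ℚ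
dimOn G S = dimAux G ∣ S ∣ S

dim≡dimOn⊤ : ∀ G → dim G ≡ dimOn G ⊤
dim≡dimOn⊤ G = cong (λ f → dimAux G f ⊤) (sym (∣⊤∣≡n (size G)))

dimAux≡dimOn : ∀ G {f} S → ∣ S ∣ ≤ f → dimAux G f S ≡ dimOn G S
dimAux≡dimOn G S p = dimAux-fuel G S p ℕ.≤-refl

-- Multiplied out, the defining recursion also holds for S = ∅, where both sides vanish.
*-dimOn : ∀ G S → fromℕ ∣ S ∣ * dimOn G S ≡ ∑[ v ∈ S ] (1ℚ + dimOn G (unitSphere G S v))
*-dimOn G S with ∣ S ∣ in e
... | zero  = trans (*-zeroˡ (dimAux G 0 S)) (sym (∑∈-empty S _ e))
... | suc m = trans (*-dimAux-suc G m S e) (∑∈-cong S λ v v∈S →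
  cong (_+_ 1ℚ) (dimAux≡dimOn G (unitSphere G S v) (∣unitSphere∣≤pred∣S∣ G S e v∈S)))

∑∈-1+dimOn-unitSphere : ∀ G S c →
  ∑[ v ∈ S ] ((1ℚ + dimOn G (unitSphere G S v)) + c) ≡ fromℕ ∣ S ∣ * (dimOn G S + c)
∑∈-1+dimOn-unitSphere G S c = begin
  ∑[ v ∈ S ] ((1ℚ + dimOn G (unitSphere G S v)) + c)
    ≡⟨ ∑∈-+ S _ _ ⟩
  ∑[ v ∈ S ] (1ℚ + dimOn G (unitSphere G S v)) + ∑[ v ∈ S ] c
    ≡⟨ cong₂ _+_ (sym (*-dimOn G S)) (∑∈-const S c) ⟩
  fromℕ ∣ S ∣ * dimOn G S + fromℕ ∣ S ∣ * c
    ≡⟨ *-distribˡ-+ (fromℕ ∣ S ∣) (dimOn G S) c ⟨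
  fromℕ ∣ S ∣ * (dimOn G S + c) ∎
  where open ≡-Reasoning

module Join (G H : Graph) where

  private
    n m : ℕ
    n = size G
    m = size H

  nbhd-⊕-↑ˡ : ∀ v → nbhd (G ⊕ H) (v ↑ˡ m) ≡ nbhd G v ++ ⊤
  nbhd-⊕-↑ˡ v = trans (tabulate-++ n (joinAdj G H (v ↑ˡ m)))
    (cong₂ _++_ (Vec.tabulate-cong adj-↑ˡ-↑ˡ) (trans (Vec.tabulate-cong adj-↑ˡ-↑ʳ) (tabulate-const m true)))
    where
    adj-↑ˡ-↑ˡ : ∀ a → joinAdj G H (v ↑ˡ m) (a ↑ˡ m) ≡ adj G v a
    adj-↑ˡ-↑ˡ a rewrite Fin.splitAt-↑ˡ n v m | Fin.splitAt-↑ˡ n a m = refl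
    adj-↑ˡ-↑ʳ : ∀ b → joinAdj G H (v ↑ˡ m) (n ↑ʳ b) ≡ true
    adj-↑ˡ-↑ʳ b rewrite Fin.splitAt-↑ˡ n v m | Fin.splitAt-↑ʳ n m b = refl

  nbhd-⊕-↑ʳ : ∀ w → nbhd (G ⊕ H) (n ↑ʳ w) ≡ ⊤ ++ nbhd H w
  nbhd-⊕-↑ʳ w = trans (tabulate-++ n (joinAdj G H (n ↑ʳ w)))
    (cong₂ _++_ (trans (Vec.tabulate-cong adj-↑ʳ-↑ˡ) (tabulate-const n true)) (Vec.tabulate-cong adj-↑ʳ-↑ʳ))
    where
    adj-↑ʳ-↑ˡ : ∀ a → joinAdj G H (n ↑ʳ w) (a ↑ˡ m) ≡ true
    adj-↑ʳ-↑ˡ a rewrite Fin.splitAt-↑ʳ n m w | Fin.splitAt-↑ˡ n a m = refl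
    adj-↑ʳ-↑ʳ : ∀ b → joinAdj G H (n ↑ʳ w) (n ↑ʳ b) ≡ adj H w b
    adj-↑ʳ-↑ʳ b rewrite Fin.splitAt-↑ʳ n m w | Fin.splitAt-↑ʳ n m b = refl

  unitSphere-⊕-↑ˡ : ∀ S T v → unitSphere (G ⊕ H) (S ++ T) (v ↑ˡ m) ≡ unitSphere G S v ++ T
  unitSphere-⊕-↑ˡ S T v = begin
    (S ++ T) ∩ nbhd (G ⊕ H) (v ↑ˡ m)   ≡⟨ cong ((S ++ T) ∩_) (nbhd-⊕-↑ˡ v) ⟩
    (S ++ T) ∩ (nbhd G v ++ ⊤)         ≡⟨ Vec.zipWith-++ _ S T (nbhd G v) ⊤ ⟩
    (S ∩ nbhd G v) ++ (T ∩ ⊤)          ≡⟨ cong ((S ∩ nbhd G v) ++_) (∩-identityʳ T) ⟩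
    (S ∩ nbhd G v) ++ T                ∎
    where open ≡-Reasoning

  unitSphere-⊕-↑ʳ : ∀ S T w → unitSphere (G ⊕ H) (S ++ T) (n ↑ʳ w) ≡ S ++ unitSphere H T w
  unitSphere-⊕-↑ʳ S T w = begin
    (S ++ T) ∩ nbhd (G ⊕ H) (n ↑ʳ w)   ≡⟨ cong ((S ++ T) ∩_) (nbhd-⊕-↑ʳ w) ⟩
    (S ++ T) ∩ (⊤ ++ nbhd H w)         ≡⟨ Vec.zipWith-++ _ S T ⊤ (nbhd H w) ⟩
    (S ∩ ⊤) ++ (T ∩ nbhd H w)          ≡⟨ cong (_++ (T ∩ nbhd H w)) (∩-identityʳ S) ⟩
    S ++ (T ∩ nbhd H w)                ∎
    where open ≡-Reasoning

  JoinFormulaBelow : ℕ → ℕ → Set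
  JoinFormulaBelow f N = ∀ S T → ∣ S ∣ ℕ.+ ∣ T ∣ < N →
    dimAux (G ⊕ H) f (S ++ T) ≡ 1ℚ + dimOn G S + dimOn H T

  private
    split-1+ : ∀ x y → 1ℚ + (1ℚ + x + y) ≡ (1ℚ + x) + (1ℚ + y)
    split-1+ = solve 2 (λ x y → con 1ℚ :+ (con 1ℚ :+ x :+ y) := (con 1ℚ :+ x) :+ (con 1ℚ :+ y)) refl
      where open ℚ-Solver.+-*-Solver

  1+dimAux-unitSphere-↑ˡ : ∀ f S T {v} → JoinFormulaBelow f (∣ S ∣ ℕ.+ ∣ T ∣) → lookup S v ≡ true →
    1ℚ + dimAux (G ⊕ H) f (unitSphere (G ⊕ H) (S ++ T) (v ↑ˡ m)) ≡
    (1ℚ + dimOn G (unitSphere G S v)) + (1ℚ + dimOn H T)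
  1+dimAux-unitSphere-↑ˡ f S T {v} below v∈S = begin
    1ℚ + dimAux (G ⊕ H) f (unitSphere (G ⊕ H) (S ++ T) (v ↑ˡ m))
      ≡⟨ cong (λ U → 1ℚ + dimAux (G ⊕ H) f U) (unitSphere-⊕-↑ˡ S T v) ⟩
    1ℚ + dimAux (G ⊕ H) f (unitSphere G S v ++ T)
      ≡⟨ cong (_+_ 1ℚ) (below (unitSphere G S v) T (ℕ.+-monoˡ-< ∣ T ∣ (∣unitSphere∣<∣S∣ G S v∈S))) ⟩
    1ℚ + (1ℚ + dimOn G (unitSphere G S v) + dimOn H T)
      ≡⟨ split-1+ (dimOn G (unitSphere G S v)) (dimOn H T) ⟩
    (1ℚ + dimOn G (unitSphere G S v)) + (1ℚ + dimOn H T) ∎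
    where open ≡-Reasoning

  1+dimAux-unitSphere-↑ʳ : ∀ f S T {w} → JoinFormulaBelow f (∣ S ∣ ℕ.+ ∣ T ∣) → lookup T w ≡ true →
    1ℚ + dimAux (G ⊕ H) f (unitSphere (G ⊕ H) (S ++ T) (n ↑ʳ w)) ≡
    (1ℚ + dimOn H (unitSphere H T w)) + (1ℚ + dimOn G S)
  1+dimAux-unitSphere-↑ʳ f S T {w} below w∈T = begin
    1ℚ + dimAux (G ⊕ H) f (unitSphere (G ⊕ H) (S ++ T) (n ↑ʳ w))
      ≡⟨ cong (λ U → 1ℚ + dimAux (G ⊕ H) f U) (unitSphere-⊕-↑ʳ S T w) ⟩
    1ℚ + dimAux (G ⊕ H) f (S ++ unitSphere H T w)
      ≡⟨ cong (_+_ 1ℚ) (below S (unitSphere H T w) (ℕ.+-monoʳ-< ∣ S ∣ (∣unitSphere∣<∣S∣ H T w∈T))) ⟩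
    1ℚ + (1ℚ + dimOn G S + dimOn H (unitSphere H T w))
      ≡⟨ split-1+ (dimOn G S) (dimOn H (unitSphere H T w)) ⟩
    (1ℚ + dimOn G S) + (1ℚ + dimOn H (unitSphere H T w))
      ≡⟨ +-comm (1ℚ + dimOn G S) (1ℚ + dimOn H (unitSphere H T w)) ⟩
    (1ℚ + dimOn H (unitSphere H T w)) + (1ℚ + dimOn G S) ∎
    where open ≡-Reasoning

  ∑∈-unitSphere-⊕ : ∀ f S T → JoinFormulaBelow f (∣ S ∣ ℕ.+ ∣ T ∣) →
    ∑[ u ∈ S ++ T ] (1ℚ + dimAux (G ⊕ H) f (unitSphere (G ⊕ H) (S ++ T) u)) ≡
    fromℕ (∣ S ∣ ℕ.+ ∣ T ∣) * (1ℚ + dimOn G S + dimOn H T)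
  ∑∈-unitSphere-⊕ f S T below = begin
    ∑[ u ∈ S ++ T ] (1ℚ + dimAux (G ⊕ H) f (unitSphere (G ⊕ H) (S ++ T) u))
      ≡⟨ ∑∈-++ S T _ ⟩
    ∑[ v ∈ S ] (1ℚ + dimAux (G ⊕ H) f (unitSphere (G ⊕ H) (S ++ T) (v ↑ˡ m))) +
    ∑[ w ∈ T ] (1ℚ + dimAux (G ⊕ H) f (unitSphere (G ⊕ H) (S ++ T) (n ↑ʳ w)))
      ≡⟨ cong₂ _+_ (∑∈-cong S λ _ → 1+dimAux-unitSphere-↑ˡ f S T below)
                   (∑∈-cong T λ _ → 1+dimAux-unitSphere-↑ʳ f S T below) ⟩
    ∑[ v ∈ S ] ((1ℚ + dimOn G (unitSphere G S v)) + (1ℚ + dimOn H T)) +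
    ∑[ w ∈ T ] ((1ℚ + dimOn H (unitSphere H T w)) + (1ℚ + dimOn G S))
      ≡⟨ cong₂ _+_ (∑∈-1+dimOn-unitSphere G S _) (∑∈-1+dimOn-unitSphere H T _) ⟩
    fromℕ ∣ S ∣ * (dimOn G S + (1ℚ + dimOn H T)) + fromℕ ∣ T ∣ * (dimOn H T + (1ℚ + dimOn G S))
      ≡⟨ collect (fromℕ ∣ S ∣) (fromℕ ∣ T ∣) (dimOn G S) (dimOn H T) ⟩
    (fromℕ ∣ S ∣ + (fromℕ ∣ T ∣)) * (1ℚ + dimOn G S + dimOn H T)
      ≡⟨ cong (_* (1ℚ + dimOn G S + dimOn H T)) (fromℕ-+ ∣ S ∣ ∣ T ∣) ⟨
    fromℕ (∣ S ∣ ℕ.+ ∣ T ∣) * (1ℚ + dimOn G S + dimOn H T) ∎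
    where
    open ≡-Reasoning
    open ℚ-Solver.+-*-Solver
    collect : ∀ a b x y → a * (x + (1ℚ + y)) + b * (y + (1ℚ + x)) ≡ (a + b) * (1ℚ + x + y)
    collect = solve 4 (λ a b x y →
      a :* (x :+ (con 1ℚ :+ y)) :+ b :* (y :+ (con 1ℚ :+ x)) := (a :+ b) :* (con 1ℚ :+ x :+ y)) refl

  dimAux-⊕ : ∀ f S T → ∣ S ∣ ℕ.+ ∣ T ∣ ≤ f →
    dimAux (G ⊕ H) f (S ++ T) ≡ 1ℚ + dimOn G S + dimOn H T
  dimAux-⊕ f S T h with ∣ S ∣ ℕ.+ ∣ T ∣ in e
  ... | zero = begin
    dimAux (G ⊕ H) f (S ++ T)      ≡⟨ dimAux-empty (G ⊕ H) f (S ++ T) (trans (∣p++q∣≡∣p∣+∣q∣ S T) e) ⟩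
    - 1ℚ                           ≡⟨⟩
    1ℚ + - 1ℚ + - 1ℚ               ≡⟨ cong₂ (λ x y → 1ℚ + x + y)
                                        (dimAux-empty G ∣ S ∣ S (ℕ.m+n≡0⇒m≡0 ∣ S ∣ e))
                                        (dimAux-empty H ∣ T ∣ T (ℕ.m+n≡0⇒n≡0 ∣ S ∣ e)) ⟨
    1ℚ + dimOn G S + dimOn H T     ∎
    where open ≡-Reasoning
  dimAux-⊕ (suc f) S T (s≤s h) | suc M = *-cancelˡ-fromℕ-suc M (begin
    fromℕ (suc M) * dimAux (G ⊕ H) (suc f) (S ++ T)
      ≡⟨ *-dimAux-suc (G ⊕ H) f (S ++ T) (trans (∣p++q∣≡∣p∣+∣q∣ S T) e) ⟩
    ∑[ u ∈ S ++ T ] (1ℚ + dimAux (G ⊕ H) f (unitSphere (G ⊕ H) (S ++ T) u))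
      ≡⟨ ∑∈-unitSphere-⊕ f S T below ⟩
    fromℕ (∣ S ∣ ℕ.+ ∣ T ∣) * (1ℚ + dimOn G S + dimOn H T)
      ≡⟨ cong (λ k → fromℕ k * (1ℚ + dimOn G S + dimOn H T)) e ⟩
    fromℕ (suc M) * (1ℚ + dimOn G S + dimOn H T) ∎)
    where
    open ≡-Reasoning
    below : JoinFormulaBelow f (∣ S ∣ ℕ.+ ∣ T ∣)
    below S′ T′ lt = dimAux-⊕ f S′ T′ (ℕ.≤-trans (ℕ.s≤s⁻¹ (ℕ.≤-trans lt (ℕ.≤-reflexive e))) h)

  dim-⊕ : dim (G ⊕ H) ≡ 1ℚ + dim G + dim H
  dim-⊕ = begin
    dimAux (G ⊕ H) (n ℕ.+ m) ⊤              ≡⟨ cong (dimAux (G ⊕ H) (n ℕ.+ m)) (⊤++⊤ n) ⟨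
    dimAux (G ⊕ H) (n ℕ.+ m) (⊤ {n} ++ ⊤ {m}) ≡⟨ dimAux-⊕ (n ℕ.+ m) ⊤ ⊤
                                                  (ℕ.≤-reflexive (cong₂ ℕ._+_ (∣⊤∣≡n n) (∣⊤∣≡n m))) ⟩
    1ℚ + dimOn G ⊤ + dimOn H ⊤              ≡⟨ cong₂ (λ x y → 1ℚ + x + y) (dim≡dimOn⊤ G) (dim≡dimOn⊤ H) ⟨
    1ℚ + dim G + dim H                      ∎
    where open ≡-Reasoning

open Join using (dim-⊕)

corollary1 : (k : ℕ) → 1 ≤ k → (Gs : Vec Graph k) →
    dim (joinAll Gs) ≡ ((+ k / 1) - 1ℚ) + sumDims Gs
corollary1 .1 _ (G ∷ []) = sym (trans (+-identityˡ (dim G + 0ℚ)) (+-identityʳ (dim G)))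
corollary1 (suc (suc k)) _ (G ∷ H ∷ Gs) = begin
  dim (G ⊕ joinAll (H ∷ Gs))
    ≡⟨ dim-⊕ G (joinAll (H ∷ Gs)) ⟩
  1ℚ + dim G + dim (joinAll (H ∷ Gs))
    ≡⟨ cong (_+_ (1ℚ + dim G)) (corollary1 (suc k) (s≤s ℕ.z≤n) (H ∷ Gs)) ⟩
  1ℚ + dim G + ((fromℕ (suc k) - 1ℚ) + sumDims (H ∷ Gs))
    ≡⟨ regroup (dim G) (fromℕ (suc k)) (sumDims (H ∷ Gs)) ⟩
  ((1ℚ + fromℕ (suc k)) - 1ℚ) + (dim G + sumDims (H ∷ Gs))
    ≡⟨ cong (λ x → (x - 1ℚ) + sumDims (G ∷ H ∷ Gs)) (fromℕ-+ 1 (suc k)) ⟨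
  (fromℕ (suc (suc k)) - 1ℚ) + sumDims (G ∷ H ∷ Gs) ∎
  where
  open ≡-Reasoning
  open ℚ-Solver.+-*-Solver
  regroup : ∀ d c s → 1ℚ + d + ((c - 1ℚ) + s) ≡ ((1ℚ + c) - 1ℚ) + (d + s)
  regroup = solve 3 (λ d c s → con 1ℚ :+ d :+ ((c :- con 1ℚ) :+ s) := ((con 1ℚ :+ c) :- con 1ℚ) :+ (d :+ s)) refl
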